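{- For every $\pi\in S_n$, $\{\overline{\sigma} : \sigma\in\pi^\circ_\circ\}=\{\gamma^m\circ\overline{\pi}\circ\gamma^{ -m} : 0\leq m\leq n\}$, where $\gamma=(0,1,2,\ldots,n)$.
   Context: Permutations are composed right to left; $\pi\in S_n$ is written $\langle \pi_1\ \cdots\ \pi_n\rangle$, $\pi_i=\pi(i)$, and identified with the permutation of $\{0,\ldots,n\}$ fixing $0$. For $\pi\in S_n$, $\overline{\pi}=(0,1,2,\ldots,n)\circ(0,\pi_n,\pi_{n-1},\ldots,\pi_1)$, a permutation of $\{0,\ldots,n\}$. The circular permutation of $\pi$ is the cyclic sequence $\pi^\circ=0\ \pi_1\ \cdots\ \pi_n$; for $0\leq m\leq n$, $m+\pi^\circ$ is the cyclic sequence obtained by replacing each entry $x$ by $(x+m)\bmod(n+1)$. Each such cyclic sequence determines a permutation in $S_n$ by reading, in cyclic order, the $n$ entries following $0$. The toric permutation $\pi^\circ_\circ$ is the set of permutations in $S_n$ so determined by $m+\pi^\circ$ for $0\leq m\leq n$. -}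

module Defs where

open import Data.Nat using (ℕ; zero; suc; _+_; _∸_)
open import Data.Fin using (Fin; zero; suc; toℕ; _≟_)
open import Data.Fin.Permutation using (Permutation′; _⟨$⟩ʳ_; _⟨$⟩ˡ_; lift₀)
open import Data.Nat.DivMod using (_mod_)
open import Data.List using (List; []; _∷_; map; reverse)
open import Data.List.Base using (allFin)
open import Data.Product using (Σ; _×_)
open import Relation.Binary.PropositionalEquality using (_≡_)
open import Relation.Nullary using (yes; no)
open import Function using (_∘_)

-- Permutations of {0,…,k-1} as endofunctions of Fin k (compared pointwise).
Endo : ℕ → Set
Endo k = Fin k → Fin k

_≗ₚ_ : ∀ {k} → Endo k → Endo k → Set
f ≗ₚ g = ∀ x → f x ≡ g x

-- Cycle notation: (a₀, a₁, …, a_r) maps a_i ↦ a_{i+1}, a_r ↦ a₀, fixes the rest.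
-- cycGo first y rest x : image of x under the tail segment y, rest of the cycle
cycGo : ∀ {k} → Fin k → Fin k → List (Fin k) → Fin k → Fin k
cycGo first y [] x with x ≟ y
... | yes _ = first
... | no  _ = x
cycGo first y (z ∷ rest) x with x ≟ y
... | yes _ = z
... | no  _ = cycGo first z rest x

cycle : ∀ {k} → List (Fin k) → Endo k
cycle [] x = x
cycle (a ∷ as) = cycGo a a as

γ : (n : ℕ) → Endo (suc n)
γ n = cycle (allFin (suc n))

γ⁻¹ : (n : ℕ) → Endo (suc n)
γ⁻¹ n x = (toℕ x + n) mod (suc n)

_^[_] : ∀ {k} → Endo k → ℕ → Endo k
f ^[ zero ] = λ x → x
f ^[ suc m ] = f ∘ (f ^[ m ])

-- π ∈ S_n identified with the permutation of {0,…,n} fixing 0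
ext : ∀ {n} → Permutation′ n → Endo (suc n)
ext π = lift₀ π ⟨$⟩ʳ_

-- π̄ = (0,1,…,n) ∘ (0, π_n, π_{n-1}, …, π_1)   (right-to-left composition)
bar : ∀ {n} → Permutation′ n → Endo (suc n)
bar {n} π = γ n ∘ cycle (zero ∷ reverse (map (λ i → ext π (suc i)) (allFin n)))

_+ₘ_ : ∀ {n} → Fin (suc n) → Fin (suc n) → Fin (suc n)
_+ₘ_ {n} a b = (toℕ a + toℕ b) mod (suc n)

-ₘ_ : ∀ {n} → Fin (suc n) → Fin (suc n)
-ₘ_ {n} a = (suc n ∸ toℕ a) mod (suc n)

-- The permutation (extended to fix 0) determined by the cyclic sequence m + π°:
-- the cyclic sequence is (π_i + m mod (n+1)) for i = 0..n (with π_0 = 0); the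
-- entry 0 sits at position p = π⁻¹(-m); the determined permutation reads the n
-- entries following it: k ↦ π_{p+k} + m  (k = 1..n; k = 0 gives 0).
toricRead : ∀ {n} → Permutation′ n → Fin (suc n) → Endo (suc n)
toricRead π m k = ext π ((lift₀ π ⟨$⟩ˡ (-ₘ m)) +ₘ k) +ₘ m

_∈Toric_ : ∀ {n} → Permutation′ n → Permutation′ n → Set
σ ∈Toric π = Σ _ λ m → ext σ ≗ₚ toricRead π m

conjBar : ∀ {n} → Permutation′ n → Fin (suc n) → Endo (suc n)
conjBar {n} π m = (γ n ^[ toℕ m ]) ∘ bar π ∘ (γ⁻¹ n ^[ toℕ m ])

-- Write τₐ for the translation x ↦ x + a of ℤ/(n+1), so that γ = τ₁. The sequence
-- (0, π_n, …, π_1) is j ↦ π(−j) read cyclically, hence π̄ = τ₁ ∘ π ∘ τ₋₁ ∘ π⁻¹ is the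
-- commutator of γ and π. The permutation read off m + π° is σ = τₘ ∘ π ∘ τₚ with
-- p = π⁻¹(−m), chosen so that σ fixes 0; in σ̄ = τ₁ ∘ σ ∘ τ₋₁ ∘ σ⁻¹ the translation τₚ
-- cancels against τ₋ₚ after commuting with τ₋₁, leaving σ̄ = τₘ ∘ π̄ ∘ τ₋ₘ = γᵐ ∘ π̄ ∘ γ⁻ᵐ.
module Submission where

open import Level using (0ℓ)
open import Algebra.Bundles using (AbelianGroup)
open import Algebra.Structures using (IsAbelianGroup)
import Algebra.Properties.AbelianGroup
import Algebra.Properties.CommutativeSemigroup
open import Data.Nat using (ℕ; NonZero; suc; zero; _+_; _∸_; _%_; s≤s)
open import Data.Nat.Properties using (+-comm; +-assoc; +-identityʳ; m+[n∸m]≡n; <⇒≤; +-∸-assoc; m∸n≤m)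
open import Data.Nat.DivMod using (_mod_; %-distribˡ-+; m%n%n≡m%n; n%n≡0; m<n⇒m%n≡m; [m+n]%n≡m%n)
open import Data.Fin using (Fin; zero; suc; toℕ; fromℕ; inject₁; opposite; _≟_)
open import Data.Fin.Properties using (toℕ-injective; toℕ<n; toℕ-fromℕ<; toℕ-fromℕ; toℕ-inject₁; opposite-prop; suc-injective)
open import Data.Fin.Relation.Unary.Top using (view; ‵fromℕ; ‵inject₁)
open import Data.Fin.Permutation using (Permutation′; _⟨$⟩ʳ_; _⟨$⟩ˡ_; lift₀; inverseˡ; inverseʳ; permutation; remove; lift₀-remove)
open import Data.List using (List; _∷_; [_]; _∷ʳ_; tabulate; reverse; map; allFin)
open import Data.List.Properties using (tabulate-cong; map-tabulate; reverse-++)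
open import Data.Product using (Σ; _×_; _,_)
open import Function using (_∘_; id)
open import Function.Bundles using (Injection)
open import Function.Definitions using (Injective)
open import Function.Properties.Inverse using (↔⇒↣)
open import Relation.Binary.PropositionalEquality using (_≡_; refl; sym; trans; cong; cong₂; isEquivalence; module ≡-Reasoning)
open import Relation.Nullary using (yes; no; contradiction)

open import Defs

module _ {d : ℕ} .{{_ : NonZero d}} where

  [m%d+n]%d≡[m+n]%d : ∀ m n → (m % d + n) % d ≡ (m + n) % d
  [m%d+n]%d≡[m+n]%d m n = begin
    (m % d + n) % d           ≡⟨ %-distribˡ-+ (m % d) n d ⟩
    (m % d % d + n % d) % d   ≡⟨ cong (λ t → (t + n % d) % d) (m%n%n≡m%n m d) ⟩
    (m % d + n % d) % d       ≡⟨ %-distribˡ-+ m n d ⟨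
    (m + n) % d               ∎
    where open ≡-Reasoning

  [m+n%d]%d≡[m+n]%d : ∀ m n → (m + n % d) % d ≡ (m + n) % d
  [m+n%d]%d≡[m+n]%d m n = begin
    (m + n % d) % d   ≡⟨ cong (_% d) (+-comm m (n % d)) ⟩
    (n % d + m) % d   ≡⟨ [m%d+n]%d≡[m+n]%d n m ⟩
    (n + m) % d       ≡⟨ cong (_% d) (+-comm n m) ⟩
    (m + n) % d       ∎
    where open ≡-Reasoning

module _ {n : ℕ} where

  private
    d : ℕ
    d = suc n

  toℕ-mod : ∀ k → toℕ (k mod d) ≡ k % d
  toℕ-mod k = toℕ-fromℕ< _

  mod-cong : ∀ k l → k % d ≡ l % d → k mod d ≡ l mod d
  mod-cong k l e = toℕ-injective (begin
    toℕ (k mod d)  ≡⟨ toℕ-mod k ⟩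
    k % d          ≡⟨ e ⟩
    l % d          ≡⟨ toℕ-mod l ⟨
    toℕ (l mod d)  ∎)
    where open ≡-Reasoning

  +ₘ-assoc : (a b c : Fin d) → (a +ₘ b) +ₘ c ≡ a +ₘ (b +ₘ c)
  +ₘ-assoc a b c = mod-cong (toℕ (a +ₘ b) + toℕ c) (toℕ a + toℕ (b +ₘ c)) (begin
    (toℕ (a +ₘ b) + toℕ c) % d          ≡⟨ cong (λ t → (t + toℕ c) % d) (toℕ-mod (toℕ a + toℕ b)) ⟩
    ((toℕ a + toℕ b) % d + toℕ c) % d   ≡⟨ [m%d+n]%d≡[m+n]%d (toℕ a + toℕ b) (toℕ c) ⟩
    (toℕ a + toℕ b + toℕ c) % d         ≡⟨ cong (_% d) (+-assoc (toℕ a) (toℕ b) (toℕ c)) ⟩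
    (toℕ a + (toℕ b + toℕ c)) % d       ≡⟨ [m+n%d]%d≡[m+n]%d (toℕ a) (toℕ b + toℕ c) ⟨
    (toℕ a + (toℕ b + toℕ c) % d) % d   ≡⟨ cong (λ t → (toℕ a + t) % d) (toℕ-mod (toℕ b + toℕ c)) ⟨
    (toℕ a + toℕ (b +ₘ c)) % d          ∎)
    where open ≡-Reasoning

  +ₘ-comm : (a b : Fin d) → a +ₘ b ≡ b +ₘ a
  +ₘ-comm a b = cong (_mod d) (+-comm (toℕ a) (toℕ b))

  +ₘ-identityʳ : (a : Fin d) → a +ₘ zero ≡ a
  +ₘ-identityʳ a = toℕ-injective (begin
    toℕ (a +ₘ zero)     ≡⟨ toℕ-mod (toℕ a + 0) ⟩
    (toℕ a + 0) % d     ≡⟨ cong (_% d) (+-identityʳ (toℕ a)) ⟩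
    toℕ a % d           ≡⟨ m<n⇒m%n≡m (toℕ<n a) ⟩
    toℕ a               ∎)
    where open ≡-Reasoning

  +ₘ-inverseʳ : (a : Fin d) → a +ₘ (-ₘ a) ≡ zero
  +ₘ-inverseʳ a = toℕ-injective (begin
    toℕ (a +ₘ (-ₘ a))                ≡⟨ toℕ-mod (toℕ a + toℕ (-ₘ a)) ⟩
    (toℕ a + toℕ (-ₘ a)) % d         ≡⟨ cong (λ t → (toℕ a + t) % d) (toℕ-mod (d ∸ toℕ a)) ⟩
    (toℕ a + (d ∸ toℕ a) % d) % d    ≡⟨ [m+n%d]%d≡[m+n]%d (toℕ a) (d ∸ toℕ a) ⟩
    (toℕ a + (d ∸ toℕ a)) % d        ≡⟨ cong (_% d) (m+[n∸m]≡n (<⇒≤ (toℕ<n a))) ⟩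
    d % d                            ≡⟨ n%n≡0 d ⟩
    0                                ∎)
    where open ≡-Reasoning

  +ₘ-identityˡ : (a : Fin d) → zero +ₘ a ≡ a
  +ₘ-identityˡ a = trans (+ₘ-comm zero a) (+ₘ-identityʳ a)

  +ₘ-inverseˡ : (a : Fin d) → (-ₘ a) +ₘ a ≡ zero
  +ₘ-inverseˡ a = trans (+ₘ-comm (-ₘ a) a) (+ₘ-inverseʳ a)

  +ₘ-isAbelianGroup : IsAbelianGroup _≡_ _+ₘ_ zero -ₘ_
  +ₘ-isAbelianGroup = record
    { isGroup = record
      { isMonoid = record
        { isSemigroup = record
          { isMagma = record { isEquivalence = isEquivalence ; ∙-cong = cong₂ _+ₘ_ }
          ; assoc = +ₘ-assoc
          }
        ; identity = +ₘ-identityˡ , +ₘ-identityʳ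
        }
      ; inverse = +ₘ-inverseˡ , +ₘ-inverseʳ
      ; ⁻¹-cong = cong -ₘ_
      }
    ; comm = +ₘ-comm
    }

+ₘ-abelianGroup : ℕ → AbelianGroup 0ℓ 0ℓ
+ₘ-abelianGroup n = record { isAbelianGroup = +ₘ-isAbelianGroup {n} }

module _ {n : ℕ} where

  1ₘ : Fin (suc n)
  1ₘ = 1 mod suc n

  toℕ-+ₘ1ₘ : (a : Fin (suc n)) → toℕ (a +ₘ 1ₘ) ≡ (toℕ a + 1) % suc n
  toℕ-+ₘ1ₘ a = begin
    toℕ (a +ₘ 1ₘ)                ≡⟨ toℕ-mod (toℕ a + toℕ 1ₘ) ⟩
    (toℕ a + toℕ 1ₘ) % suc n     ≡⟨ cong (λ t → (toℕ a + t) % suc n) (toℕ-mod 1) ⟩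
    (toℕ a + 1 % suc n) % suc n  ≡⟨ [m+n%d]%d≡[m+n]%d (toℕ a) 1 ⟩
    (toℕ a + 1) % suc n          ∎
    where open ≡-Reasoning

  inject₁-+ₘ1ₘ : (i : Fin n) → inject₁ i +ₘ 1ₘ ≡ suc i
  inject₁-+ₘ1ₘ i = toℕ-injective (begin
    toℕ (inject₁ i +ₘ 1ₘ)          ≡⟨ toℕ-+ₘ1ₘ (inject₁ i) ⟩
    (toℕ (inject₁ i) + 1) % suc n  ≡⟨ cong (λ t → (t + 1) % suc n) (toℕ-inject₁ i) ⟩
    (toℕ i + 1) % suc n            ≡⟨ cong (_% suc n) (+-comm (toℕ i) 1) ⟩
    suc (toℕ i) % suc n            ≡⟨ m<n⇒m%n≡m (s≤s (toℕ<n i)) ⟩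
    suc (toℕ i)                    ∎)
    where open ≡-Reasoning

  fromℕ-+ₘ1ₘ : fromℕ n +ₘ 1ₘ ≡ zero
  fromℕ-+ₘ1ₘ = toℕ-injective (begin
    toℕ (fromℕ n +ₘ 1ₘ)          ≡⟨ toℕ-+ₘ1ₘ (fromℕ n) ⟩
    (toℕ (fromℕ n) + 1) % suc n  ≡⟨ cong (λ t → (t + 1) % suc n) (toℕ-fromℕ n) ⟩
    (n + 1) % suc n              ≡⟨ cong (_% suc n) (+-comm n 1) ⟩
    suc n % suc n                ≡⟨ n%n≡0 (suc n) ⟩
    0                            ∎)
    where open ≡-Reasoning

  suc-opposite : (i : Fin n) → suc (opposite i) ≡ -ₘ suc i
  suc-opposite i = toℕ-injective (begin
    suc (toℕ (opposite i))   ≡⟨ cong suc (opposite-prop i) ⟩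
    suc (n ∸ suc (toℕ i))    ≡⟨ +-∸-assoc 1 (toℕ<n i) ⟨
    n ∸ toℕ i                ≡⟨ m<n⇒m%n≡m (s≤s (m∸n≤m n (toℕ i))) ⟨
    (n ∸ toℕ i) % suc n      ≡⟨ toℕ-mod (n ∸ toℕ i) ⟨
    toℕ (-ₘ suc i)           ∎)
    where open ≡-Reasoning

module _ {k : ℕ} where

  cycGo-inject₁ : ∀ {r} a (g : Fin (suc r) → Fin k) → Injective _≡_ _≡_ g → (i : Fin r) →
                  cycGo a (g zero) (tabulate (g ∘ suc)) (g (inject₁ i)) ≡ g (suc i)
  cycGo-inject₁ a g g-inj zero with g zero ≟ g zero
  ... | yes _   = refl
  ... | no g0≢g0 = contradiction refl g0≢g0
  cycGo-inject₁ a g g-inj (suc i) with g (suc (inject₁ i)) ≟ g zero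
  ... | yes gi≡g0 = contradiction (g-inj gi≡g0) λ ()
  ... | no _      = cycGo-inject₁ a (g ∘ suc) (suc-injective ∘ g-inj) i

  cycGo-fromℕ : ∀ r a (g : Fin (suc r) → Fin k) → Injective _≡_ _≡_ g →
                cycGo a (g zero) (tabulate (g ∘ suc)) (g (fromℕ r)) ≡ a
  cycGo-fromℕ zero a g g-inj with g zero ≟ g zero
  ... | yes _    = refl
  ... | no g0≢g0 = contradiction refl g0≢g0
  cycGo-fromℕ (suc r) a g g-inj with g (suc (fromℕ r)) ≟ g zero
  ... | yes gr≡g0 = contradiction (g-inj gr≡g0) λ ()
  ... | no _      = cycGo-fromℕ r a (g ∘ suc) (suc-injective ∘ g-inj)

  cycle-tabulate : ∀ {r} (g : Fin (suc r) → Fin k) → Injective _≡_ _≡_ g →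
                   ∀ j → cycle (tabulate g) (g j) ≡ g (j +ₘ 1ₘ)
  cycle-tabulate {r} g g-inj j with view j
  ... | ‵fromℕ = trans (cycGo-fromℕ r (g zero) g g-inj) (cong g (sym fromℕ-+ₘ1ₘ))
  ... | ‵inject₁ i = trans (cycGo-inject₁ (g zero) g g-inj i) (cong g (sym (inject₁-+ₘ1ₘ i)))

tabulate-∷ʳ : ∀ {A : Set} {n} (f : Fin (suc n) → A) → tabulate f ≡ tabulate (f ∘ inject₁) ∷ʳ f (fromℕ n)
tabulate-∷ʳ {n = zero}  f = refl
tabulate-∷ʳ {n = suc n} f = cong (f zero ∷_) (tabulate-∷ʳ (f ∘ suc))

reverse-tabulate : ∀ {A : Set} {n} (f : Fin n → A) → reverse (tabulate f) ≡ tabulate (f ∘ opposite)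
reverse-tabulate {n = zero}  f = refl
reverse-tabulate {n = suc n} f = begin
  reverse (tabulate f)                                ≡⟨ cong reverse (tabulate-∷ʳ f) ⟩
  reverse (tabulate (f ∘ inject₁) ∷ʳ f (fromℕ n))     ≡⟨ reverse-++ (tabulate (f ∘ inject₁)) [ f (fromℕ n) ] ⟩
  f (fromℕ n) ∷ reverse (tabulate (f ∘ inject₁))     ≡⟨ cong (f (fromℕ n) ∷_) (reverse-tabulate (f ∘ inject₁)) ⟩
  f (fromℕ n) ∷ tabulate (f ∘ inject₁ ∘ opposite)     ∎
  where open ≡-Reasoning

^-suc : ∀ {k} (f : Endo k) m x → (f ^[ suc m ]) x ≡ (f ^[ m ]) (f x)
^-suc f zero    x = refl
^-suc f (suc m) x = cong f (^-suc f m x)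

^-inverseˡ : ∀ {k} {f g : Endo k} → (∀ y → f (g y) ≡ y) → ∀ m y → (f ^[ m ]) ((g ^[ m ]) y) ≡ y
^-inverseˡ fg zero    y = refl
^-inverseˡ {f = f} {g} fg (suc m) y = begin
  (f ^[ suc m ]) (g ((g ^[ m ]) y))   ≡⟨ ^-suc f m _ ⟩
  (f ^[ m ]) (f (g ((g ^[ m ]) y)))   ≡⟨ cong (f ^[ m ]) (fg _) ⟩
  (f ^[ m ]) ((g ^[ m ]) y)           ≡⟨ ^-inverseˡ fg m y ⟩
  y                                   ∎
  where open ≡-Reasoning

module _ {n : ℕ} where

  open AbelianGroup (+ₘ-abelianGroup n) using (commutativeSemigroup)
  open Algebra.Properties.AbelianGroup (+ₘ-abelianGroup n)
    using (ε⁻¹≈ε; ⁻¹-involutive; ⁻¹-injective; ⁻¹-∙-comm; \\-leftDividesˡ; \\-leftDividesʳ; //-rightDividesˡ; //-rightDividesʳ)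
  open Algebra.Properties.CommutativeSemigroup commutativeSemigroup using (xy∙z≈xz∙y)

  private
    F : Set
    F = Fin (suc n)

  γ-+ₘ1ₘ : (x : F) → γ n x ≡ x +ₘ 1ₘ
  γ-+ₘ1ₘ = cycle-tabulate id id

  γ⁻¹∘γ : (x : F) → γ⁻¹ n (γ n x) ≡ x
  γ⁻¹∘γ x = toℕ-injective (begin
    toℕ (γ⁻¹ n (γ n x))                  ≡⟨ toℕ-mod (toℕ (γ n x) + n) ⟩
    (toℕ (γ n x) + n) % suc n            ≡⟨ cong (λ t → (toℕ t + n) % suc n) (γ-+ₘ1ₘ x) ⟩
    (toℕ (x +ₘ 1ₘ) + n) % suc n          ≡⟨ cong (λ t → (t + n) % suc n) (toℕ-+ₘ1ₘ x) ⟩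
    ((toℕ x + 1) % suc n + n) % suc n    ≡⟨ [m%d+n]%d≡[m+n]%d (toℕ x + 1) n ⟩
    (toℕ x + 1 + n) % suc n              ≡⟨ cong (_% suc n) (+-assoc (toℕ x) 1 n) ⟩
    (toℕ x + suc n) % suc n              ≡⟨ [m+n]%n≡m%n (toℕ x) (suc n) ⟩
    toℕ x % suc n                        ≡⟨ m<n⇒m%n≡m (toℕ<n x) ⟩
    toℕ x                                ∎)
    where open ≡-Reasoning

  toℕ-γ^ : ∀ k (x : F) → toℕ ((γ n ^[ k ]) x) ≡ (toℕ x + k) % suc n
  toℕ-γ^ zero    x = sym (trans (cong (_% suc n) (+-identityʳ (toℕ x))) (m<n⇒m%n≡m (toℕ<n x)))
  toℕ-γ^ (suc k) x = begin
    toℕ (γ n ((γ n ^[ k ]) x))                 ≡⟨ cong toℕ (γ-+ₘ1ₘ _) ⟩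
    toℕ ((γ n ^[ k ]) x +ₘ 1ₘ)                 ≡⟨ toℕ-+ₘ1ₘ ((γ n ^[ k ]) x) ⟩
    (toℕ ((γ n ^[ k ]) x) + 1) % suc n         ≡⟨ cong (λ t → (t + 1) % suc n) (toℕ-γ^ k x) ⟩
    ((toℕ x + k) % suc n + 1) % suc n          ≡⟨ [m%d+n]%d≡[m+n]%d (toℕ x + k) 1 ⟩
    (toℕ x + k + 1) % suc n                    ≡⟨ cong (_% suc n) (trans (+-assoc (toℕ x) k 1) (cong (toℕ x +_) (+-comm k 1))) ⟩
    (toℕ x + suc k) % suc n                    ∎
    where open ≡-Reasoning

  γ^-+ₘ : (m x : F) → (γ n ^[ toℕ m ]) x ≡ x +ₘ m
  γ^-+ₘ m x = toℕ-injective (trans (toℕ-γ^ (toℕ m) x) (sym (toℕ-mod (toℕ x + toℕ m))))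

  γ⁻¹^-+ₘ : (m x : F) → (γ⁻¹ n ^[ toℕ m ]) x ≡ x +ₘ (-ₘ m)
  γ⁻¹^-+ₘ m x = begin
    (γ⁻¹ n ^[ toℕ m ]) x                                   ≡⟨ cong (γ⁻¹ n ^[ toℕ m ]) (//-rightDividesˡ m x) ⟨
    (γ⁻¹ n ^[ toℕ m ]) ((x +ₘ (-ₘ m)) +ₘ m)                ≡⟨ cong (γ⁻¹ n ^[ toℕ m ]) (γ^-+ₘ m _) ⟨
    (γ⁻¹ n ^[ toℕ m ]) ((γ n ^[ toℕ m ]) (x +ₘ (-ₘ m)))    ≡⟨ ^-inverseˡ γ⁻¹∘γ (toℕ m) _ ⟩
    x +ₘ (-ₘ m)                                            ∎
    where open ≡-Reasoning

  conjBar-translate : (π : Permutation′ n) (m y : F) → conjBar π m y ≡ bar π (y +ₘ (-ₘ m)) +ₘ m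
  conjBar-translate π m y = trans (γ^-+ₘ m _) (cong (λ t → bar π t +ₘ m) (γ⁻¹^-+ₘ m y))

  cycle-bar : (π : Permutation′ n) →
              zero ∷ reverse (map (λ i → ext π (suc i)) (allFin n)) ≡ tabulate (λ j → ext π (-ₘ j))
  cycle-bar π = begin
    zero ∷ reverse (map (ext π ∘ suc) (allFin n))   ≡⟨ cong (λ l → zero ∷ reverse l) (map-tabulate id (ext π ∘ suc)) ⟩
    zero ∷ reverse (tabulate (ext π ∘ suc))         ≡⟨ cong (zero ∷_) (reverse-tabulate (ext π ∘ suc)) ⟩
    zero ∷ tabulate (ext π ∘ suc ∘ opposite)        ≡⟨ cong₂ _∷_ (cong (ext π) (sym ε⁻¹≈ε)) (tabulate-cong (cong (ext π) ∘ suc-opposite)) ⟩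
    tabulate (λ j → ext π (-ₘ j))                   ∎
    where open ≡-Reasoning

  bar-commutator : (π : Permutation′ n) (y : F) → bar π y ≡ ext π ((lift₀ π ⟨$⟩ˡ y) +ₘ (-ₘ 1ₘ)) +ₘ 1ₘ
  bar-commutator π y = begin
    bar π y                                     ≡⟨ γ-+ₘ1ₘ _ ⟩
    cycle L y +ₘ 1ₘ                             ≡⟨ cong (λ l → cycle l y +ₘ 1ₘ) (cycle-bar π) ⟩
    cycle (tabulate g) y +ₘ 1ₘ                  ≡⟨ cong (λ t → cycle (tabulate g) t +ₘ 1ₘ) y≡g[-π⁻¹y] ⟩
    cycle (tabulate g) (g (-ₘ π⁻¹y)) +ₘ 1ₘ      ≡⟨ cong (_+ₘ 1ₘ) (cycle-tabulate g g-injective (-ₘ π⁻¹y)) ⟩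
    g ((-ₘ π⁻¹y) +ₘ 1ₘ) +ₘ 1ₘ                   ≡⟨ cong (λ t → ext π t +ₘ 1ₘ) -[-a+1]≡a-1 ⟩
    ext π (π⁻¹y +ₘ (-ₘ 1ₘ)) +ₘ 1ₘ               ∎
    where
    open ≡-Reasoning
    L : List F
    L = zero ∷ reverse (map (λ i → ext π (suc i)) (allFin n))
    π⁻¹y : F
    π⁻¹y = lift₀ π ⟨$⟩ˡ y
    g : F → F
    g j = ext π (-ₘ j)
    g-injective : Injective _≡_ _≡_ g
    g-injective = ⁻¹-injective ∘ Injection.injective (↔⇒↣ (lift₀ π))
    y≡g[-π⁻¹y] : y ≡ g (-ₘ π⁻¹y)
    y≡g[-π⁻¹y] = sym (trans (cong (ext π) (⁻¹-involutive π⁻¹y)) (inverseʳ (lift₀ π)))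
    -[-a+1]≡a-1 : -ₘ ((-ₘ π⁻¹y) +ₘ 1ₘ) ≡ π⁻¹y +ₘ (-ₘ 1ₘ)
    -[-a+1]≡a-1 = trans (sym (⁻¹-∙-comm (-ₘ π⁻¹y) 1ₘ)) (cong (_+ₘ (-ₘ 1ₘ)) (⁻¹-involutive π⁻¹y))

  bar-translate : (σ π : Permutation′ n) (q m : F) → (∀ x → ext σ x ≡ ext π (q +ₘ x) +ₘ m) →
                  ∀ y → bar σ y ≡ bar π (y +ₘ (-ₘ m)) +ₘ m
  bar-translate σ π q m σ≡ y = begin
    bar σ y                                          ≡⟨ bar-commutator σ y ⟩
    ext σ (z +ₘ (-ₘ 1ₘ)) +ₘ 1ₘ                       ≡⟨ cong (_+ₘ 1ₘ) (σ≡ _) ⟩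
    (ext π (q +ₘ (z +ₘ (-ₘ 1ₘ))) +ₘ m) +ₘ 1ₘ         ≡⟨ cong (λ t → (ext π t +ₘ m) +ₘ 1ₘ) (sym (+ₘ-assoc q z (-ₘ 1ₘ))) ⟩
    (ext π ((q +ₘ z) +ₘ (-ₘ 1ₘ)) +ₘ m) +ₘ 1ₘ         ≡⟨ xy∙z≈xz∙y (ext π ((q +ₘ z) +ₘ (-ₘ 1ₘ))) m 1ₘ ⟩
    (ext π ((q +ₘ z) +ₘ (-ₘ 1ₘ)) +ₘ 1ₘ) +ₘ m         ≡⟨ cong (λ t → (ext π (t +ₘ (-ₘ 1ₘ)) +ₘ 1ₘ) +ₘ m) (sym π⁻¹[y-m]≡q+z) ⟩
    (ext π (π⁻¹[y-m] +ₘ (-ₘ 1ₘ)) +ₘ 1ₘ) +ₘ m         ≡⟨ cong (_+ₘ m) (bar-commutator π (y +ₘ (-ₘ m))) ⟨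
    bar π (y +ₘ (-ₘ m)) +ₘ m                         ∎
    where
    open ≡-Reasoning
    z : F
    z = lift₀ σ ⟨$⟩ˡ y
    π⁻¹[y-m] : F
    π⁻¹[y-m] = lift₀ π ⟨$⟩ˡ (y +ₘ (-ₘ m))
    π⁻¹[y-m]≡q+z : π⁻¹[y-m] ≡ q +ₘ z
    π⁻¹[y-m]≡q+z = begin
      lift₀ π ⟨$⟩ˡ (y +ₘ (-ₘ m))                              ≡⟨ cong (λ t → lift₀ π ⟨$⟩ˡ (t +ₘ (-ₘ m))) (trans (sym (inverseʳ (lift₀ σ))) (σ≡ z)) ⟩
      lift₀ π ⟨$⟩ˡ ((ext π (q +ₘ z) +ₘ m) +ₘ (-ₘ m))           ≡⟨ cong (lift₀ π ⟨$⟩ˡ_) (//-rightDividesʳ m _) ⟩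
      lift₀ π ⟨$⟩ˡ ext π (q +ₘ z)                              ≡⟨ inverseˡ (lift₀ π) ⟩
      q +ₘ z                                                  ∎

  module Toric (π : Permutation′ n) (m : F) where

    p : F
    p = lift₀ π ⟨$⟩ˡ (-ₘ m)

    toricRead⁻¹ : F → F
    toricRead⁻¹ y = (-ₘ p) +ₘ (lift₀ π ⟨$⟩ˡ (y +ₘ (-ₘ m)))

    toricRead-inverseˡ : ∀ y → toricRead π m (toricRead⁻¹ y) ≡ y
    toricRead-inverseˡ y = begin
      ext π (p +ₘ ((-ₘ p) +ₘ (lift₀ π ⟨$⟩ˡ (y +ₘ (-ₘ m))))) +ₘ m  ≡⟨ cong (λ t → ext π t +ₘ m) (\\-leftDividesˡ p _) ⟩
      ext π (lift₀ π ⟨$⟩ˡ (y +ₘ (-ₘ m))) +ₘ m                      ≡⟨ cong (_+ₘ m) (inverseʳ (lift₀ π) {y +ₘ (-ₘ m)}) ⟩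
      (y +ₘ (-ₘ m)) +ₘ m                                          ≡⟨ //-rightDividesˡ m y ⟩
      y                                                           ∎
      where open ≡-Reasoning

    toricRead-inverseʳ : ∀ x → toricRead⁻¹ (toricRead π m x) ≡ x
    toricRead-inverseʳ x = begin
      (-ₘ p) +ₘ (lift₀ π ⟨$⟩ˡ ((ext π (p +ₘ x) +ₘ m) +ₘ (-ₘ m)))  ≡⟨ cong (λ t → (-ₘ p) +ₘ (lift₀ π ⟨$⟩ˡ t)) (//-rightDividesʳ m _) ⟩
      (-ₘ p) +ₘ (lift₀ π ⟨$⟩ˡ ext π (p +ₘ x))                      ≡⟨ cong ((-ₘ p) +ₘ_) (inverseˡ (lift₀ π)) ⟩
      (-ₘ p) +ₘ (p +ₘ x)                                          ≡⟨ \\-leftDividesʳ p x ⟩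
      x                                                           ∎
      where open ≡-Reasoning

    toricRead-zero : toricRead π m zero ≡ zero
    toricRead-zero = begin
      ext π (p +ₘ zero) +ₘ m   ≡⟨ cong (λ t → ext π t +ₘ m) (+ₘ-identityʳ p) ⟩
      ext π p +ₘ m             ≡⟨ cong (_+ₘ m) (inverseʳ (lift₀ π) { -ₘ m}) ⟩
      (-ₘ m) +ₘ m              ≡⟨ +ₘ-inverseˡ m ⟩
      zero                     ∎
      where open ≡-Reasoning

    toricRead-permutation : Permutation′ (suc n)
    toricRead-permutation = permutation (toricRead π m) toricRead⁻¹ toricRead-inverseˡ toricRead-inverseʳ

    toricPermutation : Permutation′ n
    toricPermutation = remove zero toricRead-permutation

    ext-toricPermutation : ext toricPermutation ≗ₚ toricRead π m
    ext-toricPermutation = lift₀-remove toricRead-permutation toricRead-zero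

  toric⇒conjBar : (σ π : Permutation′ n) (m : F) → ext σ ≗ₚ toricRead π m → bar σ ≗ₚ conjBar π m
  toric⇒conjBar σ π m σ≗ y = trans (bar-translate σ π (Toric.p π m) m σ≗ y) (sym (conjBar-translate π m y))

corollary2 : (n : ℕ) (π : Permutation′ n) →
    ((σ : Permutation′ n) → σ ∈Toric π → Σ (Fin (suc n)) λ m → bar σ ≗ₚ conjBar π m)
    × ((m : Fin (suc n)) → Σ (Permutation′ n) λ σ → (σ ∈Toric π) × (bar σ ≗ₚ conjBar π m))
corollary2 n π = toric⇒conj , conj⇒toric
  where
  toric⇒conj : (σ : Permutation′ n) → σ ∈Toric π → Σ (Fin (suc n)) λ m → bar σ ≗ₚ conjBar π m
  toric⇒conj σ (m , σ≗) = m , toric⇒conjBar σ π m σ≗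

  conj⇒toric : (m : Fin (suc n)) → Σ (Permutation′ n) λ σ → (σ ∈Toric π) × (bar σ ≗ₚ conjBar π m)
  conj⇒toric m = toricPermutation , (m , ext-toricPermutation) , toric⇒conjBar toricPermutation π m ext-toricPermutation
    where open Toric π m
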